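{- Let $N \geq 1$ and let $f:\mathbb{R}^N \to \mathbb{R}$ be a multilinear polynomial. For any $x \in [-1/2,1/2]^N$, there exists a probability distribution $\mathcal{R}_x$ over restrictions $\rho \in \{ -1,1,*\}^N$ such that for all $i,j \in [N]$, \[ \partial_{ij} f(x) = 4\, \mathbb{E}_{\rho \sim \mathcal{R}_x}\big[\partial_{ij} f_{\rho}(0)\big]. \]
   Context: A restriction is a string $\rho \in \{ -1,1,*\}^N$; $\operatorname{free}(\rho)$ is the set of coordinates $k$ with $\rho_k = *$. For a multilinear polynomial $f:\mathbb{R}^N\to\mathbb{R}$, the restricted function $f_\rho:\mathbb{R}^N \to \mathbb{R}$ is defined by $f_\rho(y) = f(z)$ where $z_k = \rho_k$ if $\rho_k \in \{ -1,1\}$ and $z_k = y_k$ if $\rho_k = *$ (so $f_\rho$ depends only on the coordinates in $\operatorname{free}(\rho)$ and is again a multilinear polynomial). Here $\partial_i = \partial/\partial x_i$ is the usual partial derivative and $\partial_{ij} = \partial_i \partial_j$. -}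

module Defs where

open import Level using (Level; suc; _⊔_)
open import Data.Nat using (ℕ) renaming (zero to zeroℕ; suc to sucℕ)
open import Data.Fin using (Fin) renaming (zero to fzero; suc to fsuc)
open import Data.Vec using (Vec; []; _∷_)
open import Data.List using (List; []; _∷_; map; concatMap; foldr)

open import Relation.Nullary using (¬_)
open import Algebra.Bundles using (CommutativeRing)
open import Relation.Binary.Structures using (IsTotalOrder)

record OrderedField (c ℓ₁ ℓ₂ : Level) : Set (suc (c ⊔ ℓ₁ ⊔ ℓ₂)) where
  field
    commutativeRing : CommutativeRing c ℓ₁
  open CommutativeRing commutativeRing public
  field
    _≤_          : Carrier → Carrier → Set ℓ₂
    isTotalOrder : IsTotalOrder _≈_ _≤_
    0≉1          : ¬ (0# ≈ 1#)
    _⁻¹          : Carrier → Carrier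
    ⁻¹-inverse   : ∀ x → ¬ (x ≈ 0#) → x * (x ⁻¹) ≈ 1#
    +-mono-≤     : ∀ x y z → x ≤ y → (x + z) ≤ (y + z)
    *-nonneg     : ∀ x y → 0# ≤ x → 0# ≤ y → 0# ≤ (x * y)

data Sym : Set where
  neg pos star : Sym

Restriction : ℕ → Set
Restriction N = Vec Sym N

allRestrictions : (N : ℕ) → List (Restriction N)
allRestrictions zeroℕ = [] ∷ []
allRestrictions (sucℕ N) =
  concatMap (λ ρ → (neg ∷ ρ) ∷ (pos ∷ ρ) ∷ (star ∷ ρ) ∷ []) (allRestrictions N)

-- Multilinear polynomials over an ordered field, in recursive form:
-- a polynomial in N+1 variables x₀,x₁,…,x_N is a pair (a , b)
-- standing for a(x₁,…,x_N) + x₀ · b(x₁,…,x_N).  Every multilinear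
-- polynomial has exactly one such representation.

module _ {c ℓ₁ ℓ₂} (F : OrderedField c ℓ₁ ℓ₂) where
  open OrderedField F

  data MLPoly : ℕ → Set c where
    const : Carrier → MLPoly zeroℕ
    _,_   : ∀ {N} → MLPoly N → MLPoly N → MLPoly (sucℕ N)

  eval : ∀ {N} → MLPoly N → (Fin N → Carrier) → Carrier
  eval {zeroℕ}   (const a) x = a
  eval {sucℕ N} (a , b) x =
    eval a (λ k → x (fsuc k)) + x fzero * eval b (λ k → x (fsuc k))

  zeroP : ∀ {N} → MLPoly N
  zeroP {zeroℕ}   = const 0#
  zeroP {sucℕ N} = zeroP , zeroP

  addP : ∀ {N} → MLPoly N → MLPoly N → MLPoly N
  addP {zeroℕ}   (const a) (const a') = const (a + a')
  addP {sucℕ N} (a , b) (a' , b') = addP a a' , addP b b'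

  negP : ∀ {N} → MLPoly N → MLPoly N
  negP {zeroℕ}   (const a) = const (- a)
  negP {sucℕ N} (a , b) = negP a , negP b

  ∂ : ∀ {N} → Fin N → MLPoly N → MLPoly N
  ∂ fzero    (a , b) = b , zeroP
  ∂ (fsuc i) (a , b) = ∂ i a , ∂ i b

  ∂² : ∀ {N} → Fin N → Fin N → MLPoly N → MLPoly N
  ∂² i j f = ∂ i (∂ j f)

  -- restricted polynomial f_ρ (again a polynomial in N variables,
  -- depending only on the free coordinates)
  restrict : ∀ {N} → Restriction N → MLPoly N → MLPoly N
  restrict {zeroℕ}   []         a       = a
  restrict {sucℕ N} (neg  ∷ ρ) (a , b) = restrict ρ (addP a (negP b)) , zeroP
  restrict {sucℕ N} (pos  ∷ ρ) (a , b) = restrict ρ (addP a b) , zeroP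
  restrict {sucℕ N} (star ∷ ρ) (a , b) = restrict ρ a , restrict ρ b

  sumL : ∀ {A : Set} → (A → Carrier) → List A → Carrier
  sumL g = foldr (λ a s → g a + s) 0#

  record Distribution (N : ℕ) : Set (c ⊔ ℓ₁ ⊔ ℓ₂) where
    field
      weight     : Restriction N → Carrier
      nonneg     : ∀ ρ → 0# ≤ weight ρ
      total      : sumL weight (allRestrictions N) ≈ 1#

  𝔼 : ∀ {N} → Distribution N → (Restriction N → Carrier) → Carrier
  𝔼 {N} D g = sumL (λ ρ → Distribution.weight D ρ * g ρ) (allRestrictions N)

  origin : ∀ {N} → Fin N → Carrier
  origin _ = 0#

-- Draw the coordinates of ρ independently, ρ_k = * with probability 1/2 and
-- ρ_k = ±1 with probability (1 ± 2 x_k)/4; these are probabilities because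
-- |x_k| ≤ 1/2, and the value of ρ_k at the origin (-1, 1, or 0 for *) has mean x_k.
-- Write f = a + x₀ b with a, b free of x₀. Fixing ρ₀ turns f into a + v b with v the
-- value of ρ₀, whose mean over ρ₀ is a + x₀ b; by induction on the number of
-- variables f(x) = E[f_ρ(0)], and likewise D f(x) = E[D f_ρ(0)] for any linear D
-- acting on a and b separately. The derivative ∂₀ f = b survives only the restrictions
-- with ρ₀ = *, which have probability 1/2, so ∂₀ f(x) = 2 E[∂₀ f_ρ(0)]: every
-- derivative costs a factor 2, and ∂ᵢ∂ⱼ costs 4 (when i = j both sides vanish).

module Submission where

open import Defs
open import Level using (_⊔_)
open import Data.Nat using (ℕ; _≥_)
open import Data.Fin using (Fin)
open import Data.Product using (Σ; _×_; _,_; proj₁; proj₂)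
open import Data.Nat using () renaming (zero to zeroℕ; suc to sucℕ)
open import Data.Fin using () renaming (zero to fzero; suc to fsuc)
open import Data.Vec using (_∷_; [])
open import Data.List using (List; []; _∷_; _++_; map; concatMap)
open import Data.Sum using (inj₁; inj₂)
open import Data.Vec.Functional using (head; tail)
open import Relation.Nullary using (¬_)
open import Data.Empty using (⊥-elim)
open import Relation.Binary.Structures using (IsTotalOrder)
import Relation.Binary.PropositionalEquality as ≡
open ≡ using (_≡_)
import Relation.Binary.Reasoning.Setoid as SetoidReasoning
import Algebra.Properties.Ring as RingProperties
import Algebra.Properties.CommutativeSemigroup as CommutativeSemigroupProperties

module OrderedFieldProperties {c ℓ₁ ℓ₂} (F : OrderedField c ℓ₁ ℓ₂) where
  open OrderedField F
  open IsTotalOrder isTotalOrder using (total; antisym; ≤-respˡ-≈; ≤-respʳ-≈)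
  open RingProperties ring using (-1*x≈-x; -‿distribʳ-*; -‿involutive)

  two four : Carrier
  two = 1# + 1#
  four = two + 1# + 1#

  two+two≈four : two + two ≈ four
  two+two≈four = sym (+-assoc two 1# 1#)

  two*two≈four : two * two ≈ four
  two*two≈four =
    trans (distribˡ two 1# 1#) (trans (+-cong (*-identityʳ two) (*-identityʳ two)) two+two≈four)

  x≤y⇒0≤y-x : ∀ {x y} → x ≤ y → 0# ≤ (y - x)
  x≤y⇒0≤y-x {x} {y} x≤y = ≤-respˡ-≈ (-‿inverseʳ x) (+-mono-≤ x y (- x) x≤y)

  x≤0⇒0≤-x : ∀ {x} → x ≤ 0# → 0# ≤ (- x)
  x≤0⇒0≤-x {x} x≤0 = ≤-respʳ-≈ (+-identityˡ (- x)) (x≤y⇒0≤y-x x≤0)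

  0≤-x⇒x≤0 : ∀ {x} → 0# ≤ (- x) → x ≤ 0#
  0≤-x⇒x≤0 {x} 0≤-x =
    ≤-respˡ-≈ (+-identityˡ x) (≤-respʳ-≈ (-‿inverseˡ x) (+-mono-≤ 0# (- x) x 0≤-x))

  +-nonneg : ∀ {x y} → 0# ≤ x → 0# ≤ y → 0# ≤ (x + y)
  +-nonneg {x} {y} 0≤x 0≤y =
    IsTotalOrder.trans isTotalOrder (≤-respʳ-≈ (sym (+-identityˡ y)) 0≤y) (+-mono-≤ 0# x y 0≤x)

  0≤1 : 0# ≤ 1#
  0≤1 with total 0# 1#
  ... | inj₁ 0≤1 = 0≤1
  ... | inj₂ 1≤0 =
    ≤-respʳ-≈ (trans (-1*x≈-x (- 1#)) (-‿involutive 1#)) (*-nonneg (- 1#) (- 1#) 0≤-1 0≤-1)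
    where
    0≤-1 : 0# ≤ (- 1#)
    0≤-1 = x≤0⇒0≤-x 1≤0

  1≰0 : ¬ (1# ≤ 0#)
  1≰0 1≤0 = 0≉1 (antisym 0≤1 1≤0)

  0≤two : 0# ≤ two
  0≤two = +-nonneg 0≤1 0≤1

  0≤four : 0# ≤ four
  0≤four = +-nonneg (+-nonneg 0≤two 0≤1) 0≤1

  four≉0 : ¬ (four ≈ 0#)
  four≉0 four≈0 = 1≰0 (≤-respʳ-≈ four≈0 1≤four)
    where
    1≤four : 1# ≤ four
    1≤four = ≤-respˡ-≈ (+-identityˡ 1#) (+-mono-≤ 0# (two + 1#) 1# (+-nonneg 0≤two 0≤1))

  ⁻¹-nonneg : ∀ {x} → 0# ≤ x → ¬ (x ≈ 0#) → 0# ≤ (x ⁻¹)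
  ⁻¹-nonneg {x} 0≤x x≉0 with total 0# (x ⁻¹)
  ... | inj₁ 0≤x⁻¹ = 0≤x⁻¹
  ... | inj₂ x⁻¹≤0 = ⊥-elim (1≰0 (0≤-x⇒x≤0 0≤-1))
    where
    0≤-1 : 0# ≤ (- 1#)
    0≤-1 = ≤-respʳ-≈ (trans (sym (-‿distribʳ-* x (x ⁻¹))) (-‿cong (⁻¹-inverse x x≉0)))
                     (*-nonneg x (- (x ⁻¹)) 0≤x (x≤0⇒0≤-x x⁻¹≤0))

module Sums {c ℓ₁ ℓ₂} (F : OrderedField c ℓ₁ ℓ₂) where
  open OrderedField F
  open CommutativeSemigroupProperties *-commutativeSemigroup using (x∙yz≈y∙xz)
  open CommutativeSemigroupProperties +-commutativeSemigroup using (interchange)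

  module _ {A : Set} where

    sumL-cong : {g h : A → Carrier} (L : List A) → (∀ a → g a ≈ h a) → sumL F g L ≈ sumL F h L
    sumL-cong []      g≈h = refl
    sumL-cong (a ∷ L) g≈h = +-cong (g≈h a) (sumL-cong L g≈h)

    sumL-zero : (L : List A) → sumL F (λ _ → 0#) L ≈ 0#
    sumL-zero []      = refl
    sumL-zero (a ∷ L) = trans (+-identityˡ _) (sumL-zero L)

    sumL-+ : (g h : A → Carrier) (L : List A) → sumL F (λ a → g a + h a) L ≈ sumL F g L + sumL F h L
    sumL-+ g h []      = sym (+-identityʳ 0#)
    sumL-+ g h (a ∷ L) = trans (+-congˡ (sumL-+ g h L)) (interchange (g a) (h a) _ _)

    sumL-*ˡ : (k : Carrier) (g : A → Carrier) (L : List A) → sumL F (λ a → k * g a) L ≈ k * sumL F g L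
    sumL-*ˡ k g []      = sym (zeroʳ k)
    sumL-*ˡ k g (a ∷ L) = trans (+-congˡ (sumL-*ˡ k g L)) (sym (distribˡ k (g a) _))

    sumL-*ʳ : (k : Carrier) (g : A → Carrier) (L : List A) → sumL F (λ a → g a * k) L ≈ sumL F g L * k
    sumL-*ʳ k g []      = sym (zeroˡ k)
    sumL-*ʳ k g (a ∷ L) = trans (+-congˡ (sumL-*ʳ k g L)) (sym (distribʳ k (g a) _))

    sumL-++ : (g : A → Carrier) (L M : List A) → sumL F g (L ++ M) ≈ sumL F g L + sumL F g M
    sumL-++ g []      M = sym (+-identityˡ _)
    sumL-++ g (a ∷ L) M = trans (+-congˡ (sumL-++ g L M)) (sym (+-assoc (g a) _ _))

    weightedSum : (A → Carrier) → (A → Carrier) → List A → Carrier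
    weightedSum w g = sumL F (λ a → w a * g a)

    weightedSum-cong : (w : A → Carrier) {g h : A → Carrier} (L : List A) → (∀ a → g a ≈ h a) →
                       weightedSum w g L ≈ weightedSum w h L
    weightedSum-cong w L g≈h = sumL-cong L (λ a → *-congˡ (g≈h a))

    weightedSum-+ : (w g h : A → Carrier) (L : List A) →
                    weightedSum w (λ a → g a + h a) L ≈ weightedSum w g L + weightedSum w h L
    weightedSum-+ w g h L = trans (sumL-cong L (λ a → distribˡ (w a) (g a) (h a))) (sumL-+ _ _ L)

    weightedSum-*ˡ : (w : A → Carrier) (k : Carrier) (g : A → Carrier) (L : List A) →
                     weightedSum w (λ a → k * g a) L ≈ k * weightedSum w g L
    weightedSum-*ˡ w k g L = trans (sumL-cong L (λ a → x∙yz≈y∙xz (w a) k (g a))) (sumL-*ˡ k _ L)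

    weightedSum-*ʳ : (w : A → Carrier) (k : Carrier) (g : A → Carrier) (L : List A) →
                     weightedSum w (λ a → g a * k) L ≈ weightedSum w g L * k
    weightedSum-*ʳ w k g L = trans (sumL-cong L (λ a → sym (*-assoc (w a) (g a) k))) (sumL-*ʳ k _ L)

  sumL-concatMap : ∀ {A B : Set} (g : B → Carrier) (k : A → List B) (L : List A) →
                   sumL F g (concatMap k L) ≈ sumL F (λ a → sumL F g (k a)) L
  sumL-concatMap g k []      = refl
  sumL-concatMap g k (a ∷ L) = trans (sumL-++ g (k a) (concatMap k L)) (+-congˡ (sumL-concatMap g k L))

  sumL-swap : ∀ {A B : Set} (g : A → B → Carrier) (L : List A) (M : List B) →
              sumL F (λ a → sumL F (g a) M) L ≈ sumL F (λ b → sumL F (λ a → g a b) L) M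
  sumL-swap g []      M = sym (sumL-zero M)
  sumL-swap g (a ∷ L) M = trans (+-congˡ (sumL-swap g L M)) (sym (sumL-+ (g a) _ M))

module PolynomialProperties {c ℓ₁ ℓ₂} (F : OrderedField c ℓ₁ ℓ₂) where
  open OrderedField F
  open RingProperties ring using (-‿distribʳ-*; -0#≈0#; -‿+-comm)
  open CommutativeSemigroupProperties +-commutativeSemigroup using (interchange)

  -- Coefficientwise equality: ∂, addP and negP commute only up to 0# + 0# ≈ 0# and - 0# ≈ 0#.
  infix 4 _≋_

  data _≋_ : ∀ {N} → MLPoly F N → MLPoly F N → Set (c ⊔ ℓ₁) where
    const : ∀ {a a'} → a ≈ a' → const a ≋ const a'
    _,_   : ∀ {N} {a a' b b' : MLPoly F N} → a ≋ a' → b ≋ b' → (a , b) ≋ (a' , b')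

  ≋-refl : ∀ {N} {f : MLPoly F N} → f ≋ f
  ≋-refl {f = const a} = const refl
  ≋-refl {f = a , b}   = ≋-refl , ≋-refl

  ≋-trans : ∀ {N} {f g h : MLPoly F N} → f ≋ g → g ≋ h → f ≋ h
  ≋-trans (const p) (const q) = const (trans p q)
  ≋-trans (p , p′)  (q , q′)  = ≋-trans p q , ≋-trans p′ q′

  ≡⇒≋ : ∀ {N} {f g : MLPoly F N} → f ≡ g → f ≋ g
  ≡⇒≋ ≡.refl = ≋-refl

  zeroP≋addP : ∀ {N} → zeroP F {N} ≋ addP F (zeroP F) (zeroP F)
  zeroP≋addP {zeroℕ}  = const (sym (+-identityʳ 0#))
  zeroP≋addP {sucℕ N} = zeroP≋addP , zeroP≋addP

  zeroP≋negP : ∀ {N} → zeroP F {N} ≋ negP F (zeroP F)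
  zeroP≋negP {zeroℕ}  = const (sym -0#≈0#)
  zeroP≋negP {sucℕ N} = zeroP≋negP , zeroP≋negP

  ∂-zeroP : ∀ {N} (i : Fin N) → ∂ F i (zeroP F) ≡ zeroP F
  ∂-zeroP fzero = ≡.refl
  ∂-zeroP (fsuc i) rewrite ∂-zeroP i = ≡.refl

  ∂-cong : ∀ {N} (i : Fin N) {f g : MLPoly F N} → f ≋ g → ∂ F i f ≋ ∂ F i g
  ∂-cong fzero    (a≋a′ , b≋b′) = b≋b′ , ≋-refl
  ∂-cong (fsuc i) (a≋a′ , b≋b′) = ∂-cong i a≋a′ , ∂-cong i b≋b′

  ∂-addP : ∀ {N} (i : Fin N) (f g : MLPoly F N) → ∂ F i (addP F f g) ≋ addP F (∂ F i f) (∂ F i g)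
  ∂-addP fzero    (a , b) (a′ , b′) = ≋-refl , zeroP≋addP
  ∂-addP (fsuc i) (a , b) (a′ , b′) = ∂-addP i a a′ , ∂-addP i b b′

  ∂-negP : ∀ {N} (i : Fin N) (f : MLPoly F N) → ∂ F i (negP F f) ≋ negP F (∂ F i f)
  ∂-negP fzero    (a , b) = ≋-refl , zeroP≋negP
  ∂-negP (fsuc i) (a , b) = ∂-negP i a , ∂-negP i b

  eval-cong : ∀ {N} {f g : MLPoly F N} (y : Fin N → Carrier) → f ≋ g → eval F f y ≈ eval F g y
  eval-cong y (const a≈a′)  = a≈a′
  eval-cong y (a≋a′ , b≋b′) = +-cong (eval-cong _ a≋a′) (*-congˡ (eval-cong _ b≋b′))

  eval-zeroP : ∀ {N} (y : Fin N → Carrier) → eval F (zeroP F) y ≈ 0#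
  eval-zeroP {zeroℕ}  y = refl
  eval-zeroP {sucℕ N} y =
    trans (+-cong (eval-zeroP {N} _) (trans (*-congˡ (eval-zeroP {N} _)) (zeroʳ _))) (+-identityʳ 0#)

  eval-addP : ∀ {N} (f g : MLPoly F N) (y : Fin N → Carrier) →
              eval F (addP F f g) y ≈ eval F f y + eval F g y
  eval-addP (const a) (const a′) y = refl
  eval-addP (a , b)   (a′ , b′)  y =
    trans (+-cong (eval-addP a a′ _) (trans (*-congˡ (eval-addP b b′ _)) (distribˡ _ _ _)))
          (interchange _ _ _ _)

  eval-negP : ∀ {N} (f : MLPoly F N) (y : Fin N → Carrier) → eval F (negP F f) y ≈ - eval F f y
  eval-negP (const a) y = refl
  eval-negP (a , b)   y =
    trans (+-cong (eval-negP a _) (trans (*-congˡ (eval-negP b _)) (sym (-‿distribʳ-* _ _))))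
          (-‿+-comm _ _)

  record Linear {N} (D : MLPoly F N → MLPoly F N) : Set (c ⊔ ℓ₁) where
    field
      cong      : ∀ {f g} → f ≋ g → D f ≋ D g
      zero-homo : D (zeroP F) ≋ zeroP F
      +-homo    : ∀ f g → D (addP F f g) ≋ addP F (D f) (D g)
      -‿homo    : ∀ f → D (negP F f) ≋ negP F (D f)

  linear-id : ∀ {N} → Linear {N} (λ f → f)
  linear-id = record
    { cong      = λ f≋g → f≋g
    ; zero-homo = ≋-refl
    ; +-homo    = λ _ _ → ≋-refl
    ; -‿homo    = λ _ → ≋-refl
    }

  linear-∂ : ∀ {N} (i : Fin N) → Linear (∂ F i)
  linear-∂ i = record
    { cong      = ∂-cong i
    ; zero-homo = ≡⇒≋ (∂-zeroP i)
    ; +-homo    = ∂-addP i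
    ; -‿homo    = ∂-negP i
    }

  linear-∘ : ∀ {N} {D D′ : MLPoly F N → MLPoly F N} → Linear D → Linear D′ → Linear (λ f → D (D′ f))
  linear-∘ {D′ = D′} lin lin′ = record
    { cong      = λ f≋g → L.cong (L′.cong f≋g)
    ; zero-homo = ≋-trans (L.cong L′.zero-homo) L.zero-homo
    ; +-homo    = λ f g → ≋-trans (L.cong (L′.+-homo f g)) (L.+-homo (D′ f) (D′ g))
    ; -‿homo    = λ f → ≋-trans (L.cong (L′.-‿homo f)) (L.-‿homo (D′ f))
    }
    where
    module L = Linear lin
    module L′ = Linear lin′

module RestrictionDistribution {c ℓ₁ ℓ₂} (F : OrderedField c ℓ₁ ℓ₂) where
  open OrderedField F
  open IsTotalOrder isTotalOrder using (≤-respʳ-≈)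
  open RingProperties ring using (-1*x≈-x; -‿involutive; -‿+-comm; x[y-z]≈xy-xz)
  open CommutativeSemigroupProperties +-commutativeSemigroup using (interchange)
  open CommutativeSemigroupProperties *-commutativeSemigroup using (x∙yz≈y∙xz)
  open SetoidReasoning setoid
  open OrderedFieldProperties F
  open Sums F

  quarter : Carrier
  quarter = four ⁻¹

  quarter*four≈1 : quarter * four ≈ 1#
  quarter*four≈1 = trans (*-comm quarter four) (⁻¹-inverse four four≉0)

  weight₁ : Carrier → Sym → Carrier
  weight₁ t neg  = quarter * (1# - two * t)
  weight₁ t pos  = quarter * (1# + two * t)
  weight₁ t star = quarter * two

  value isFree : Sym → Carrier
  value neg  = - 1#
  value pos  = 1#
  value star = 0#
  isFree neg  = 0#
  isFree pos  = 0#
  isFree star = 1#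

  weight₁-sum : ∀ t → weight₁ t neg + (weight₁ t pos + weight₁ t star) ≈ 1#
  weight₁-sum t = begin
    quarter * (1# - u) + (quarter * (1# + u) + quarter * two)  ≈⟨ +-congˡ (distribˡ quarter _ _) ⟨
    quarter * (1# - u) + quarter * ((1# + u) + two)           ≈⟨ distribˡ quarter _ _ ⟨
    quarter * ((1# - u) + ((1# + u) + two))                   ≈⟨ *-congˡ (+-assoc (1# - u) (1# + u) two) ⟨
    quarter * (((1# - u) + (1# + u)) + two)                   ≈⟨ *-congˡ (+-congʳ (interchange 1# (- u) 1# u)) ⟩
    quarter * ((two + (- u + u)) + two)                       ≈⟨ *-congˡ (+-congʳ (+-congˡ (-‿inverseˡ u))) ⟩
    quarter * ((two + 0#) + two)                              ≈⟨ *-congˡ (+-congʳ (+-identityʳ two)) ⟩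
    quarter * (two + two)                                     ≈⟨ *-congˡ two+two≈four ⟩
    quarter * four                                            ≈⟨ quarter*four≈1 ⟩
    1#                                                        ∎
    where u = two * t

  weight₁-difference : ∀ t → weight₁ t pos - weight₁ t neg ≈ t
  weight₁-difference t = begin
    quarter * (1# + u) - quarter * (1# - u)     ≈⟨ x[y-z]≈xy-xz quarter _ _ ⟨
    quarter * ((1# + u) - (1# - u))             ≈⟨ *-congˡ (+-congˡ (-‿+-comm 1# (- u))) ⟨
    quarter * ((1# + u) + (- 1# + - - u))       ≈⟨ *-congˡ (+-congˡ (+-congˡ (-‿involutive u))) ⟩
    quarter * ((1# + u) + (- 1# + u))           ≈⟨ *-congˡ (interchange 1# u (- 1#) u) ⟩
    quarter * ((1# - 1#) + (u + u))             ≈⟨ *-congˡ (+-congʳ (-‿inverseʳ 1#)) ⟩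
    quarter * (0# + (u + u))                    ≈⟨ *-congˡ (+-identityˡ (u + u)) ⟩
    quarter * (two * t + two * t)               ≈⟨ *-congˡ (distribʳ t two two) ⟨
    quarter * ((two + two) * t)                 ≈⟨ *-congˡ (*-congʳ two+two≈four) ⟩
    quarter * (four * t)                        ≈⟨ *-assoc quarter four t ⟨
    (quarter * four) * t                        ≈⟨ *-congʳ quarter*four≈1 ⟩
    1# * t                                      ≈⟨ *-identityˡ t ⟩
    t                                           ∎
    where u = two * t

  two*weight₁-star : ∀ t → two * weight₁ t star ≈ 1#
  two*weight₁-star t = begin
    two * (quarter * two)  ≈⟨ x∙yz≈y∙xz two quarter two ⟩
    quarter * (two * two)  ≈⟨ *-congˡ two*two≈four ⟩
    quarter * four         ≈⟨ quarter*four≈1 ⟩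
    1#                     ∎

  symbols : List Sym
  symbols = neg ∷ pos ∷ star ∷ []

  E₁ : Carrier → (Sym → Carrier) → Carrier
  E₁ t u = weightedSum (weight₁ t) u symbols

  E₁-one : ∀ t → E₁ t (λ _ → 1#) ≈ 1#
  E₁-one t = trans (+-cong (*-identityʳ _) (+-cong (*-identityʳ _) (trans (+-identityʳ _) (*-identityʳ _))))
                   (weight₁-sum t)

  E₁-value : ∀ t → E₁ t value ≈ t
  E₁-value t = begin
    weight₁ t neg * - 1# + (weight₁ t pos * 1# + (weight₁ t star * 0# + 0#))
      ≈⟨ +-congˡ (+-cong (*-identityʳ _) (trans (+-identityʳ _) (zeroʳ _))) ⟩
    weight₁ t neg * - 1# + (weight₁ t pos + 0#)  ≈⟨ +-cong (*-comm _ (- 1#)) (+-identityʳ _) ⟩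
    - 1# * weight₁ t neg + weight₁ t pos         ≈⟨ +-congʳ (-1*x≈-x _) ⟩
    - weight₁ t neg + weight₁ t pos              ≈⟨ +-comm _ _ ⟩
    weight₁ t pos - weight₁ t neg                ≈⟨ weight₁-difference t ⟩
    t                                            ∎

  E₁-isFree : ∀ t → E₁ t isFree ≈ weight₁ t star
  E₁-isFree t = begin
    weight₁ t neg * 0# + (weight₁ t pos * 0# + (weight₁ t star * 1# + 0#))
      ≈⟨ +-cong (zeroʳ _) (+-cong (zeroʳ _) (+-identityʳ _)) ⟩
    0# + (0# + weight₁ t star * 1#)        ≈⟨ trans (+-identityˡ _) (+-identityˡ _) ⟩
    weight₁ t star * 1#                    ≈⟨ *-identityʳ _ ⟩
    weight₁ t star                         ∎

  E₁-affine : ∀ t a b → E₁ t (λ s → a + value s * b) ≈ a + t * b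
  E₁-affine t a b = begin
    E₁ t (λ s → a + value s * b)
      ≈⟨ weightedSum-+ (weight₁ t) (λ _ → a) (λ s → value s * b) symbols ⟩
    E₁ t (λ _ → a) + E₁ t (λ s → value s * b)
      ≈⟨ +-congʳ (weightedSum-cong (weight₁ t) symbols (λ _ → sym (*-identityˡ a))) ⟩
    E₁ t (λ _ → 1# * a) + E₁ t (λ s → value s * b)
      ≈⟨ +-cong (weightedSum-*ʳ (weight₁ t) a (λ _ → 1#) symbols) (weightedSum-*ʳ (weight₁ t) b value symbols) ⟩
    E₁ t (λ _ → 1#) * a + E₁ t value * b
      ≈⟨ +-cong (trans (*-congʳ (E₁-one t)) (*-identityˡ a)) (*-congʳ (E₁-value t)) ⟩
    a + t * b
      ∎

  two*E₁-isFree : ∀ t b → two * E₁ t (λ s → isFree s * b) ≈ b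
  two*E₁-isFree t b = begin
    two * E₁ t (λ s → isFree s * b)   ≈⟨ *-congˡ (weightedSum-*ʳ (weight₁ t) b isFree symbols) ⟩
    two * (E₁ t isFree * b)           ≈⟨ *-congˡ (*-congʳ (E₁-isFree t)) ⟩
    two * (weight₁ t star * b)        ≈⟨ *-assoc two _ b ⟨
    (two * weight₁ t star) * b        ≈⟨ *-congʳ (two*weight₁-star t) ⟩
    1# * b                            ≈⟨ *-identityˡ b ⟩
    b                                 ∎

  weight : ∀ {N} → (Fin N → Carrier) → Restriction N → Carrier
  weight x []      = 1#
  weight x (s ∷ ρ) = weight₁ (head x) s * weight (tail x) ρ

  E : ∀ {N} → (Fin N → Carrier) → (Restriction N → Carrier) → Carrier
  E {N} x g = weightedSum (weight x) g (allRestrictions N)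

  E-cong : ∀ {N} (x : Fin N → Carrier) {g h : Restriction N → Carrier} → (∀ ρ → g ρ ≈ h ρ) → E x g ≈ E x h
  E-cong {N} x = weightedSum-cong (weight x) (allRestrictions N)

  E-*ˡ : ∀ {N} (x : Fin N → Carrier) (k : Carrier) (g : Restriction N → Carrier) →
         E x (λ ρ → k * g ρ) ≈ k * E x g
  E-*ˡ {N} x k g = weightedSum-*ˡ (weight x) k g (allRestrictions N)

  E-zero : ∀ {N} (x : Fin N → Carrier) → E x (λ _ → 0#) ≈ 0#
  E-zero {N} x = trans (sumL-cong L (λ ρ → zeroʳ (weight x ρ))) (sumL-zero L)
    where L = allRestrictions N

  E-suc : ∀ {N} (x : Fin (sucℕ N) → Carrier) (g : Restriction (sucℕ N) → Carrier) →
          E x g ≈ E₁ (head x) (λ s → E (tail x) (λ ρ → g (s ∷ ρ)))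
  E-suc {N} x g = begin
    E x g
      ≈⟨ sumL-concatMap (λ ρ → weight x ρ * g ρ) (λ ρ → map (_∷ ρ) symbols) L ⟩
    sumL F (λ ρ → sumL F (λ s → (weight₁ t s * weight (tail x) ρ) * g (s ∷ ρ)) symbols) L
      ≈⟨ sumL-cong L (λ ρ → sumL-cong symbols (λ s → *-assoc (weight₁ t s) (weight (tail x) ρ) (g (s ∷ ρ)))) ⟩
    sumL F (λ ρ → sumL F (λ s → weight₁ t s * (weight (tail x) ρ * g (s ∷ ρ))) symbols) L
      ≈⟨ sumL-swap (λ ρ s → weight₁ t s * (weight (tail x) ρ * g (s ∷ ρ))) L symbols ⟩
    sumL F (λ s → sumL F (λ ρ → weight₁ t s * (weight (tail x) ρ * g (s ∷ ρ))) L) symbols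
      ≈⟨ sumL-cong symbols (λ s → sumL-*ˡ (weight₁ t s) (λ ρ → weight (tail x) ρ * g (s ∷ ρ)) L) ⟩
    E₁ t (λ s → E (tail x) (λ ρ → g (s ∷ ρ)))
      ∎
    where
    L = allRestrictions N
    t = head x

  *-E-suc : ∀ {N} (x : Fin (sucℕ N) → Carrier) (c : Carrier) {g : Restriction (sucℕ N) → Carrier}
            (G : Sym → Restriction N → Carrier) → (∀ s ρ → g (s ∷ ρ) ≈ G s ρ) →
            c * E x g ≈ E₁ (head x) (λ s → c * E (tail x) (G s))
  *-E-suc x c {g} G g≈G = begin
    c * E x g
      ≈⟨ *-congˡ (E-suc x g) ⟩
    c * E₁ (head x) (λ s → E (tail x) (λ ρ → g (s ∷ ρ)))
      ≈⟨ weightedSum-*ˡ (weight₁ (head x)) c (λ s → E (tail x) (λ ρ → g (s ∷ ρ))) symbols ⟨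
    E₁ (head x) (λ s → c * E (tail x) (λ ρ → g (s ∷ ρ)))
      ≈⟨ weightedSum-cong (weight₁ (head x)) symbols (λ s → *-congˡ {c} (E-cong (tail x) (g≈G s))) ⟩
    E₁ (head x) (λ s → c * E (tail x) (G s))
      ∎

  E-one : ∀ {N} (x : Fin N → Carrier) → E x (λ _ → 1#) ≈ 1#
  E-one {zeroℕ}  x = trans (+-identityʳ _) (*-identityʳ 1#)
  E-one {sucℕ N} x = begin
    E x (λ _ → 1#)                             ≈⟨ E-suc x (λ _ → 1#) ⟩
    E₁ (head x) (λ _ → E (tail x) (λ _ → 1#))  ≈⟨ weightedSum-cong (weight₁ (head x)) symbols (λ _ → E-one (tail x)) ⟩
    E₁ (head x) (λ _ → 1#)                     ≈⟨ E₁-one (head x) ⟩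
    1#                                         ∎

  0≤quarter : 0# ≤ quarter
  0≤quarter = ⁻¹-nonneg 0≤four four≉0

  weight₁-nonneg : ∀ {t} → (- 1#) ≤ (two * t) → (two * t) ≤ 1# → ∀ s → 0# ≤ weight₁ t s
  weight₁-nonneg -1≤2t 2t≤1 neg  = *-nonneg quarter _ 0≤quarter (x≤y⇒0≤y-x 2t≤1)
  weight₁-nonneg -1≤2t 2t≤1 pos  = *-nonneg quarter _ 0≤quarter
    (≤-respʳ-≈ (trans (+-congˡ (-‿involutive 1#)) (+-comm _ 1#)) (x≤y⇒0≤y-x -1≤2t))
  weight₁-nonneg -1≤2t 2t≤1 star = *-nonneg quarter two 0≤quarter 0≤two

  weight-nonneg : ∀ {N} {x : Fin N → Carrier} → (∀ k → (- 1#) ≤ (two * x k) × (two * x k) ≤ 1#) →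
                  ∀ ρ → 0# ≤ weight x ρ
  weight-nonneg hx []      = 0≤1
  weight-nonneg hx (s ∷ ρ) =
    *-nonneg _ _ (weight₁-nonneg (proj₁ (hx fzero)) (proj₂ (hx fzero)) s)
                 (weight-nonneg (λ k → hx (fsuc k)) ρ)

  restrictionDistribution : ∀ {N} (x : Fin N → Carrier) →
                            (∀ k → (- 1#) ≤ (two * x k) × (two * x k) ≤ 1#) → Distribution F N
  restrictionDistribution {N} x hx = record
    { weight = weight x
    ; nonneg = weight-nonneg hx
    ; total  = trans (sumL-cong (allRestrictions N) (λ ρ → sym (*-identityʳ (weight x ρ)))) (E-one x)
    }

module RestrictionFormulas {c ℓ₁ ℓ₂} (F : OrderedField c ℓ₁ ℓ₂) where
  open OrderedField F
  open RingProperties ring using (-1*x≈-x)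
  open CommutativeSemigroupProperties *-commutativeSemigroup using (x∙yz≈y∙xz)
  open SetoidReasoning setoid
  open OrderedFieldProperties F using (two; four; two*two≈four)
  open Sums F using (weightedSum-cong)
  open PolynomialProperties F
  open RestrictionDistribution F

  -- A record rather than a Π-type, so that D and κ can be inferred from a proof of it.
  record RestrictionFormula {N} (x : Fin N → Carrier) (D : MLPoly F N → MLPoly F N) (κ : Carrier) :
                            Set (c ⊔ ℓ₁) where
    field
      holds : ∀ f → eval F (D f) x ≈ κ * E x (λ ρ → eval F (D (restrict F ρ f)) (origin F))

  open RestrictionFormula

  lift : ∀ {N} → (MLPoly F N → MLPoly F N) → MLPoly F (sucℕ N) → MLPoly F (sucℕ N)
  lift D (a , b) = D a , D b

  substValue : ∀ {N} → Sym → MLPoly F N → MLPoly F N → MLPoly F N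
  substValue neg  a b = addP F a (negP F b)
  substValue pos  a b = addP F a b
  substValue star a b = a

  eval-pair-origin : ∀ {N} (a b : MLPoly F N) → eval F (a , b) (origin F) ≈ eval F a (origin F)
  eval-pair-origin a b = trans (+-congˡ (zeroˡ _)) (+-identityʳ _)

  module _ {N} {D : MLPoly F N → MLPoly F N} (linear : Linear D) where
    open Linear linear

    eval-zero-homo : ∀ y → eval F (D (zeroP F)) y ≈ 0#
    eval-zero-homo y = trans (eval-cong y zero-homo) (eval-zeroP y)

    eval-+-homo : ∀ f g y → eval F (D (addP F f g)) y ≈ eval F (D f) y + eval F (D g) y
    eval-+-homo f g y = trans (eval-cong y (+-homo f g)) (eval-addP _ _ y)

    eval-substValue : ∀ s a b y →
                      eval F (D (substValue s a b)) y ≈ eval F (D a) y + value s * eval F (D b) y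
    eval-substValue neg a b y = begin
      eval F (D (addP F a (negP F b))) y      ≈⟨ eval-+-homo a (negP F b) y ⟩
      eval F (D a) y + eval F (D (negP F b)) y ≈⟨ +-congˡ (trans (eval-cong y (-‿homo b)) (eval-negP _ y)) ⟩
      eval F (D a) y + - eval F (D b) y        ≈⟨ +-congˡ (-1*x≈-x _) ⟨
      eval F (D a) y + - 1# * eval F (D b) y   ∎
    eval-substValue pos  a b y = trans (eval-+-homo a b y) (+-congˡ (sym (*-identityˡ _)))
    eval-substValue star a b y = sym (trans (+-congˡ (zeroˡ _)) (+-identityʳ _))

  restrictionFormula-resp : ∀ {N} {x : Fin N → Carrier} {D D′ : MLPoly F N → MLPoly F N} {κ κ′} →
                            (∀ f → D f ≡ D′ f) → κ ≈ κ′ → RestrictionFormula x D κ → RestrictionFormula x D′ κ′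
  restrictionFormula-resp {x = x} {D} {D′} {κ} {κ′} D≡D′ κ≈κ′ formula .holds f = begin
    eval F (D′ f) x                                           ≡⟨ ≡.cong (λ p → eval F p x) (D≡D′ f) ⟨
    eval F (D f) x                                            ≈⟨ formula .holds f ⟩
    κ * E x (λ ρ → eval F (D (restrict F ρ f)) (origin F))    ≈⟨ *-cong κ≈κ′ (E-cong x D≈D′-at-origin) ⟩
    κ′ * E x (λ ρ → eval F (D′ (restrict F ρ f)) (origin F))  ∎
    where
    D≈D′-at-origin : ∀ ρ → eval F (D (restrict F ρ f)) (origin F) ≈ eval F (D′ (restrict F ρ f)) (origin F)
    D≈D′-at-origin ρ = reflexive (≡.cong (λ p → eval F p (origin F)) (D≡D′ (restrict F ρ f)))

  restrictionFormula-zero : ∀ {N} (x : Fin N → Carrier) κ → RestrictionFormula x (λ _ → zeroP F) κ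
  restrictionFormula-zero {N} x κ .holds f = begin
    eval F (zeroP F) x                              ≈⟨ eval-zeroP x ⟩
    0#                                              ≈⟨ zeroʳ κ ⟨
    κ * 0#                                          ≈⟨ *-congˡ (E-zero x) ⟨
    κ * E x (λ _ → 0#)                              ≈⟨ *-congˡ (E-cong x (λ _ → sym (eval-zeroP {N} (origin F)))) ⟩
    κ * E x (λ _ → eval F (zeroP F {N}) (origin F)) ∎

  restrictionFormula-lift : ∀ {N} (x : Fin (sucℕ N) → Carrier) {D : MLPoly F N → MLPoly F N} {κ} →
                            Linear D → RestrictionFormula (tail x) D κ → RestrictionFormula x (lift D) κ
  restrictionFormula-lift {N} x {D} {κ} linear formula .holds (a , b) = begin
    eval F (D a) (tail x) + head x * eval F (D b) (tail x)
      ≈⟨ E₁-affine (head x) _ _ ⟨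
    E₁ (head x) (λ s → eval F (D a) (tail x) + value s * eval F (D b) (tail x))
      ≈⟨ weightedSum-cong (weight₁ (head x)) symbols (λ s → sym (eval-substValue linear s a b (tail x))) ⟩
    E₁ (head x) (λ s → eval F (D (substValue s a b)) (tail x))
      ≈⟨ weightedSum-cong (weight₁ (head x)) symbols (λ s → formula .holds (substValue s a b)) ⟩
    E₁ (head x) (λ s → κ * E (tail x) (λ ρ → eval F (D (restrict F ρ (substValue s a b))) (origin F)))
      ≈⟨ *-E-suc x κ (λ s ρ → eval F (D (restrict F ρ (substValue s a b))) (origin F)) lift-restrict ⟨
    κ * E x (λ ρ → eval F (lift D (restrict F ρ (a , b))) (origin F))
      ∎
    where
    lift-restrict : ∀ s ρ → eval F (lift D (restrict F (s ∷ ρ) (a , b))) (origin F)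
                              ≈ eval F (D (restrict F ρ (substValue s a b))) (origin F)
    lift-restrict neg  ρ = eval-pair-origin {N} _ _
    lift-restrict pos  ρ = eval-pair-origin {N} _ _
    lift-restrict star ρ = eval-pair-origin {N} _ _

  restrictionFormula-∂₀-lift : ∀ {N} (x : Fin (sucℕ N) → Carrier) {D : MLPoly F N → MLPoly F N} {κ} →
                               Linear D → RestrictionFormula (tail x) D κ →
                               RestrictionFormula x (λ f → ∂ F fzero (lift D f)) (two * κ)
  restrictionFormula-∂₀-lift {N} x {D} {κ} linear formula .holds (a , b) = begin
    eval F (D b) (tail x) + head x * eval F (zeroP F) (tail x)
      ≈⟨ trans (+-congˡ (trans (*-congˡ (eval-zeroP (tail x))) (zeroʳ _))) (+-identityʳ _) ⟩
    eval F (D b) (tail x)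
      ≈⟨ two*E₁-isFree (head x) _ ⟨
    two * E₁ (head x) (λ s → isFree s * eval F (D b) (tail x))
      ≈⟨ *-congˡ (weightedSum-cong (weight₁ (head x)) symbols (λ s → *-congˡ {isFree s} (formula .holds b))) ⟩
    two * E₁ (head x) (λ s → isFree s * (κ * E (tail x) v))
      ≈⟨ *-congˡ (weightedSum-cong (weight₁ (head x)) symbols isFree-inside) ⟩
    two * E₁ (head x) (λ s → κ * E (tail x) (λ ρ → isFree s * v ρ))
      ≈⟨ *-congˡ (*-E-suc x κ (λ s ρ → isFree s * v ρ) ∂₀-lift-restrict) ⟨
    two * (κ * E x (λ ρ → eval F (∂ F fzero (lift D (restrict F ρ (a , b)))) (origin F)))
      ≈⟨ *-assoc two κ _ ⟨
    (two * κ) * E x (λ ρ → eval F (∂ F fzero (lift D (restrict F ρ (a , b)))) (origin F))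
      ∎
    where
    v : Restriction N → Carrier
    v ρ = eval F (D (restrict F ρ b)) (origin F)

    isFree-inside : ∀ s → isFree s * (κ * E (tail x) v) ≈ κ * E (tail x) (λ ρ → isFree s * v ρ)
    isFree-inside s = trans (x∙yz≈y∙xz (isFree s) κ _) (*-congˡ (sym (E-*ˡ (tail x) (isFree s) v)))

    ∂₀-lift-restrict : ∀ s ρ →
                       eval F (∂ F fzero (lift D (restrict F (s ∷ ρ) (a , b)))) (origin F) ≈ isFree s * v ρ
    ∂₀-lift-restrict neg  ρ =
      trans (eval-pair-origin {N} _ _) (trans (eval-zero-homo linear _) (sym (zeroˡ (v ρ))))
    ∂₀-lift-restrict pos  ρ =
      trans (eval-pair-origin {N} _ _) (trans (eval-zero-homo linear _) (sym (zeroˡ (v ρ))))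
    ∂₀-lift-restrict star ρ = trans (eval-pair-origin {N} _ _) (sym (*-identityˡ (v ρ)))

  restrictionFormula-id : ∀ {N} (x : Fin N → Carrier) → RestrictionFormula x (λ f → f) 1#
  restrictionFormula-id {zeroℕ}  x .holds (const a) =
    sym (trans (*-identityˡ _) (trans (+-identityʳ _) (*-identityˡ a)))
  restrictionFormula-id {sucℕ N} x =
    restrictionFormula-resp (λ { (a , b) → ≡.refl }) refl
      (restrictionFormula-lift x linear-id (restrictionFormula-id (tail x)))

  restrictionFormula-∂ : ∀ {N} (x : Fin N → Carrier) (j : Fin N) → RestrictionFormula x (∂ F j) two
  restrictionFormula-∂ x fzero =
    restrictionFormula-resp (λ { (a , b) → ≡.refl }) (*-identityʳ two)
      (restrictionFormula-∂₀-lift x linear-id (restrictionFormula-id (tail x)))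
  restrictionFormula-∂ x (fsuc j) =
    restrictionFormula-resp (λ { (a , b) → ≡.refl }) refl
      (restrictionFormula-lift x (linear-∂ j) (restrictionFormula-∂ (tail x) j))

  restrictionFormula-∂² : ∀ {N} (x : Fin N → Carrier) (i j : Fin N) → RestrictionFormula x (∂² F i j) four
  restrictionFormula-∂² x fzero fzero =
    restrictionFormula-resp (λ { (a , b) → ≡.refl }) refl (restrictionFormula-zero x four)
  restrictionFormula-∂² x fzero (fsuc j) =
    restrictionFormula-resp (λ { (a , b) → ≡.refl }) two*two≈four
      (restrictionFormula-∂₀-lift x (linear-∂ j) (restrictionFormula-∂ (tail x) j))
  restrictionFormula-∂² x (fsuc i) fzero =
    restrictionFormula-resp (λ { (a , b) → ≡.cong (∂ F i b ,_) (≡.sym (∂-zeroP i)) }) two*two≈four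
      (restrictionFormula-∂₀-lift x (linear-∂ i) (restrictionFormula-∂ (tail x) i))
  restrictionFormula-∂² x (fsuc i) (fsuc j) =
    restrictionFormula-resp (λ { (a , b) → ≡.refl }) refl
      (restrictionFormula-lift x (linear-∘ (linear-∂ i) (linear-∂ j))
                                 (restrictionFormula-∂² (tail x) i j))

open RestrictionDistribution using (restrictionDistribution)
open RestrictionFormulas using (module RestrictionFormula; restrictionFormula-∂²)

lemma2p2 : ∀ {c ℓ₁ ℓ₂} (F : OrderedField c ℓ₁ ℓ₂) → let open OrderedField F in
    (N : ℕ) → N ≥ 1 → (f : MLPoly F N) → (x : Fin N → Carrier) →
    (∀ k → (- 1#) ≤ ((1# + 1#) * x k) × ((1# + 1#) * x k) ≤ 1#) →
    Σ (Distribution F N) λ R → ∀ (i j : Fin N) →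
      eval F (∂² F i j f) x
        ≈ (1# + 1# + 1# + 1#) * 𝔼 F R (λ ρ → eval F (∂² F i j (restrict F ρ f)) (origin F))
lemma2p2 F N _ f x hx =
  restrictionDistribution F x hx , λ i j → RestrictionFormula.holds (restrictionFormula-∂² F x i j) f
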